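{- Let $A$ be an integral domain, let $\alpha:\mathbf{N}\to\mathrm{End}^*(A[q])$ and $u:\mathbf{N}\to\mathbf{N}$ be homomorphisms, let $P$ be a set of prime numbers, and let $\{h_p(q):p\in P\}$ be a set of nonzero polynomials in $A[q]$ such that $$h_{p_1}(q)\,\alpha_{u(p_1)}(h_{p_2}(q))=h_{p_2}(q)\,\alpha_{u(p_2)}(h_{p_1}(q))$$ for all $p_1,p_2\in P$. Then there exists a unique sequence $\{f_n(q)\}_{n=1}^\infty$ of polynomials in $A[q]$ satisfying the functional equation $f_{mn}(q)=f_m(q)\,\alpha_{u(m)}(f_n(q))$ for all $m,n\in\mathbf{N}$, such that $f_p(q)=h_p(q)$ for all $p\in P$ and $\{n\in\mathbf{N}: f_n(q)\neq0\}=S(P)$.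
   Context: Semigroup homomorphisms preserve products and identity elements. $\mathbf{N}=\{1,2,3,\dots\}$ is the multiplicative semigroup of positive integers; a homomorphism $u:\mathbf{N}\to\mathbf{N}$ is a completely multiplicative function with $u(1)=1$. $A[q]$ is the multiplicative semigroup of polynomials over $A$. $\mathrm{End}^*(A[q])$ is the semigroup, under composition, of semigroup homomorphisms $\varphi:A[q]\to A[q]$ (so $\varphi(1)=1$, $\varphi(fg)=\varphi(f)\varphi(g)$) with $\varphi(0)=0$ and $\varphi(f)\ne0$ for $f\ne0$; a homomorphism $\alpha:\mathbf{N}\to\mathrm{End}^*(A[q])$ satisfies $\alpha_{mn}=\alpha_m\circ\alpha_n$ and $\alpha_1=\mathrm{id}$, where $\alpha_t$ denotes the image of $t$. For a set $P$ of primes, $S(P)$ is the semigroup of positive integers all of whose prime factors lie in $P$. -}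

module Defs where

open import Level using (Level; _⊔_; Lift)
open import Algebra.Bundles using (CommutativeRing)
open import Data.Nat as ℕ using (ℕ; _≤_)
open import Data.Nat.Divisibility using (_∣_)
open import Data.Nat.Primality using (Prime)
open import Data.List using (List; []; _∷_; map)
open import Data.Product using (Σ; _×_; _,_)
open import Data.Sum using (_⊎_)
open import Data.Unit.Polymorphic using (⊤)
open import Relation.Nullary using (¬_)

IsIntegralDomain : ∀ {c ℓ} → CommutativeRing c ℓ → Set (c ⊔ ℓ)
IsIntegralDomain R = ¬ (1# ≈ 0#) × (∀ a b → a * b ≈ 0# → (a ≈ 0#) ⊎ (b ≈ 0#))
  where open CommutativeRing R

-- Positive-integer semigroup N = {1,2,3,...} is modelled by ℕ with a
-- hypothesis 1 ≤ n wherever an element of N is meant.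

InS : (ℕ → Set) → ℕ → Set
InS P n = (1 ≤ n) × (∀ p → Prime p → p ∣ n → P p)

IsHomN : (ℕ → ℕ) → Set
IsHomN u = (∀ n → 1 ≤ n → 1 ≤ u n)
         × (u 1 ≡ 1)
         × (∀ m n → 1 ≤ m → 1 ≤ n → u (m ℕ.* n) ≡ u m ℕ.* u n)
  where open import Relation.Binary.PropositionalEquality using (_≡_)

-- Polynomials A[q] over a commutative ring, as coefficient lists
-- (constant term first), with equality up to trailing zero coefficients.
module Poly {c ℓ} (R : CommutativeRing c ℓ) where
  open CommutativeRing R

  Pol : Set c
  Pol = List Carrier

  infix 4 _≈ₚ_
  _≈ₚ_ : Pol → Pol → Set ℓ
  []      ≈ₚ []      = ⊤
  []      ≈ₚ (b ∷ q) = (0# ≈ b) × ([] ≈ₚ q)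
  (a ∷ p) ≈ₚ []      = (a ≈ 0#) × (p ≈ₚ [])
  (a ∷ p) ≈ₚ (b ∷ q) = (a ≈ b) × (p ≈ₚ q)

  0ₚ : Pol
  0ₚ = []

  1ₚ : Pol
  1ₚ = 1# ∷ []

  infixl 6 _+ₚ_
  _+ₚ_ : Pol → Pol → Pol
  []      +ₚ q       = q
  (a ∷ p) +ₚ []      = a ∷ p
  (a ∷ p) +ₚ (b ∷ q) = (a + b) ∷ (p +ₚ q)

  infixl 7 _*ₚ_
  _*ₚ_ : Pol → Pol → Pol
  []      *ₚ q = []
  (a ∷ p) *ₚ q = map (a *_) q +ₚ (0# ∷ (p *ₚ q))

  IsEnd* : (Pol → Pol) → Set (c ⊔ ℓ)
  IsEnd* φ = (∀ f g → f ≈ₚ g → φ f ≈ₚ φ g)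
           × (φ 1ₚ ≈ₚ 1ₚ)
           × (∀ f g → φ (f *ₚ g) ≈ₚ φ f *ₚ φ g)
           × (φ 0ₚ ≈ₚ 0ₚ)
           × (∀ f → ¬ (f ≈ₚ 0ₚ) → ¬ (φ f ≈ₚ 0ₚ))

  IsHomα : (ℕ → Pol → Pol) → Set (c ⊔ ℓ)
  IsHomα α = (∀ t → 1 ≤ t → IsEnd* (α t))
           × (∀ f → α 1 f ≈ₚ f)
           × (∀ m n → 1 ≤ m → 1 ≤ n → ∀ f → α (m ℕ.* n) f ≈ₚ α m (α n f))

  Good : (ℕ → Pol → Pol) → (ℕ → ℕ) → (P : ℕ → Set) → (ℕ → Pol) → (ℕ → Pol) → Set ℓ
  Good α u P h f =
      (∀ m n → 1 ≤ m → 1 ≤ n → f (m ℕ.* n) ≈ₚ f m *ₚ α (u m) (f n))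
    × (∀ p → P p → f p ≈ₚ h p)
    × (∀ n → 1 ≤ n → (¬ (f n ≈ₚ 0ₚ) → InS P n) × (InS P n → ¬ (f n ≈ₚ 0ₚ)))

{-# OPTIONS --safe #-}

-- Write n = p₁ ⋯ pₖ as a product of primes. The functional equation forces
-- f_n = h_{p₁} α_{u(p₁)}(h_{p₂} α_{u(p₂)}(⋯ h_{pₖ} ⋯)) if every pᵢ lies in P and
-- f_n = 0 otherwise, starting from f_1 = 1, the only nonzero idempotent of the
-- domain A[q]; this gives uniqueness. For existence, take this right fold over
-- the prime factorisation as the definition. The compatibility condition on the
-- h_p says exactly that two adjacent factors can be swapped, so by uniqueness of
-- factorisation the fold does not depend on the order of the primes, and the
-- functional equation follows by concatenating factorisations of m and n.
module Submission where

open import Defs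
open import Level using (Level)
open import Axiom.ExcludedMiddle using (ExcludedMiddle)
open import Algebra.Bundles using (CommutativeRing; AbelianGroup)
open import Algebra.Structures using (IsAbelianGroup)
import Algebra.Consequences.Setoid as Consequences
import Algebra.Properties.CommutativeSemigroup as CommutativeSemigroupProperties
import Algebra.Properties.Group as GroupProperties
import Algebra.Properties.Ring as RingProperties
open import Data.Nat as ℕ using (ℕ; zero; suc; _≤_)
import Data.Nat.Properties as ℕₚ
open import Data.Nat.Divisibility using (_∣_; m∣m*n)
open import Data.Nat.ListAction using (product)
open import Data.Nat.ListAction.Properties using (product-++; ∈⇒∣product)
open import Data.Nat.Primality using (Prime; prime⇒nonZero; productOfPrimes≥1; productOfPrimes≢0)
open import Data.Nat.Primality.Factorisation
  using (PrimeFactorisation; factors; factorise; primeFactorisation[1]; primeFactorisation[p];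
         factorisationHasAllPrimeFactors; factorisationUnique)
open import Data.List using (List; []; _∷_; _++_; map; foldr)
open import Data.List.Relation.Unary.All as All using (All; []; _∷_)
open import Data.List.Relation.Unary.All.Properties using (++⁺)
open import Data.List.Relation.Binary.Permutation.Propositional as ↭ using (_↭_)
open import Data.Product using (Σ; _×_; _,_; proj₁; proj₂)
open import Data.Sum using (_⊎_; inj₁; inj₂)
open import Data.Empty using (⊥-elim)
open import Function using (_∘_)
open import Relation.Nullary using (¬_; yes; no; contradiction)
open import Relation.Binary.PropositionalEquality as ≡ using (_≡_; cong; subst)
open import Relation.Binary.Bundles using (Setoid)
open import Relation.Binary.Structures using (IsEquivalence)
import Relation.Binary.Reasoning.Setoid as SetoidReasoning

open PrimeFactorisation using (isFactorisation; factorsPrime)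

factorisation-* : ∀ {m n} → PrimeFactorisation m → PrimeFactorisation n →
                  PrimeFactorisation (m ℕ.* n)
factorisation-* φ ψ = record
  { factors         = factors φ ++ factors ψ
  ; isFactorisation = ≡.trans (≡.cong₂ ℕ._*_ (isFactorisation φ) (isFactorisation ψ))
                              (≡.sym (product-++ (factors φ) (factors ψ)))
  ; factorsPrime    = ++⁺ (factorsPrime φ) (factorsPrime ψ)
  }

prime⇒1≤ : ∀ {p} → Prime p → 1 ≤ p
prime⇒1≤ p-prime = ℕ.>-nonZero⁻¹ _ {{prime⇒nonZero p-prime}}

factorisation : ∀ {n} → 1 ≤ n → PrimeFactorisation n
factorisation {suc n} _ = factorise (suc n)

module _ {P : ℕ → Set} {n} (φ : PrimeFactorisation n) where

  InS⇒All : InS P n → All P (factors φ)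
  InS⇒All (_ , P-primeDivisors) = All.tabulate λ {p} p∈φ →
    P-primeDivisors p (All.lookup (factorsPrime φ) p∈φ)
                      (subst (p ∣_) (≡.sym (isFactorisation φ)) (∈⇒∣product p∈φ))

  All⇒InS : All P (factors φ) → InS P n
  All⇒InS P-factors =
      subst (1 ≤_) (≡.sym (isFactorisation φ)) (productOfPrimes≥1 (factorsPrime φ))
    , λ p p-prime p∣n → All.lookup P-factors
        (factorisationHasAllPrimeFactors p-prime (subst (p ∣_) (isFactorisation φ) p∣n)
                                         (factorsPrime φ))

module IntegralDomain {c ℓ} (R : CommutativeRing c ℓ) (dom : IsIntegralDomain R) where
  open CommutativeRing R
  open RingProperties ring using (x[y-z]≈xy-xz)
  open GroupProperties +-group using (x≈y⇒x∙y⁻¹≈ε; x∙y⁻¹≈ε⇒x≈y)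

  *-cancelˡ-nonzero : ∀ {a b c} → ¬ a ≈ 0# → a * b ≈ a * c → b ≈ c
  *-cancelˡ-nonzero {a} {b} {c} a≉0 ab≈ac
    with proj₂ dom a (b - c) (trans (x[y-z]≈xy-xz a b c) (x≈y⇒x∙y⁻¹≈ε ab≈ac))
  ... | inj₁ a≈0   = ⊥-elim (a≉0 a≈0)
  ... | inj₂ b-c≈0 = x∙y⁻¹≈ε⇒x≈y b c b-c≈0

  nonzero-idempotent⇒≈1 : ∀ {e} → ¬ e ≈ 0# → e * e ≈ e → e ≈ 1#
  nonzero-idempotent⇒≈1 {e} e≉0 ee≈e = *-cancelˡ-nonzero e≉0 (trans ee≈e (sym (*-identityʳ e)))

module Polynomial {c ℓ} (A : CommutativeRing c ℓ) where
  open CommutativeRing A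
  open Poly A
  module ≈-Reasoning = SetoidReasoning setoid

  coeff : Pol → ℕ → Carrier
  coeff []      _       = 0#
  coeff (a ∷ p) zero    = a
  coeff (a ∷ p) (suc i) = coeff p i

  -- Unlike _≈ₚ_, which is defined by recursion on both lists, this record
  -- determines p and q, so they can be left implicit.
  infix 4 _≋_
  record _≋_ (p q : Pol) : Set ℓ where
    constructor coeffwise
    field coeff-≈ : ∀ i → coeff p i ≈ coeff q i
  open _≋_ public

  ≈ₚ⇒coeff-≈ : ∀ p q → p ≈ₚ q → ∀ i → coeff p i ≈ coeff q i
  ≈ₚ⇒coeff-≈ []      []      _       i       = refl
  ≈ₚ⇒coeff-≈ []      (b ∷ q) (e , _) zero    = e
  ≈ₚ⇒coeff-≈ []      (b ∷ q) (_ , E) (suc i) = ≈ₚ⇒coeff-≈ [] q E i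
  ≈ₚ⇒coeff-≈ (a ∷ p) []      (e , _) zero    = e
  ≈ₚ⇒coeff-≈ (a ∷ p) []      (_ , E) (suc i) = ≈ₚ⇒coeff-≈ p [] E i
  ≈ₚ⇒coeff-≈ (a ∷ p) (b ∷ q) (e , _) zero    = e
  ≈ₚ⇒coeff-≈ (a ∷ p) (b ∷ q) (_ , E) (suc i) = ≈ₚ⇒coeff-≈ p q E i

  coeff-≈⇒≈ₚ : ∀ p q → (∀ i → coeff p i ≈ coeff q i) → p ≈ₚ q
  coeff-≈⇒≈ₚ []      []      E = _
  coeff-≈⇒≈ₚ []      (b ∷ q) E = E 0 , coeff-≈⇒≈ₚ [] q (E ∘ suc)
  coeff-≈⇒≈ₚ (a ∷ p) []      E = E 0 , coeff-≈⇒≈ₚ p [] (E ∘ suc)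
  coeff-≈⇒≈ₚ (a ∷ p) (b ∷ q) E = E 0 , coeff-≈⇒≈ₚ p q (E ∘ suc)

  ≈ₚ⇒≋ : ∀ {p q} → p ≈ₚ q → p ≋ q
  ≈ₚ⇒≋ {p} {q} e = coeffwise (≈ₚ⇒coeff-≈ p q e)

  ≋⇒≈ₚ : ∀ {p q} → p ≋ q → p ≈ₚ q
  ≋⇒≈ₚ {p} {q} e = coeff-≈⇒≈ₚ p q (coeff-≈ e)

  ≋-isEquivalence : IsEquivalence _≋_
  ≋-isEquivalence = record
    { refl  = coeffwise λ _ → refl
    ; sym   = λ e → coeffwise λ i → sym (coeff-≈ e i)
    ; trans = λ e e′ → coeffwise λ i → trans (coeff-≈ e i) (coeff-≈ e′ i)
    }

  ≋-setoid : Setoid c ℓ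
  ≋-setoid = record { isEquivalence = ≋-isEquivalence }

  module ≋-Reasoning = SetoidReasoning ≋-setoid

  open IsEquivalence ≋-isEquivalence public
    using () renaming (refl to ≋-refl; sym to ≋-sym; trans to ≋-trans; reflexive to ≋-reflexive)

  ∷-cong : ∀ {a b p q} → a ≈ b → p ≋ q → a ∷ p ≋ b ∷ q
  ∷-cong a≈b p≋q = coeffwise λ { zero → a≈b ; (suc i) → coeff-≈ p≋q i }

  ∷≋0ₚ : ∀ {a p} → a ≈ 0# → p ≋ 0ₚ → a ∷ p ≋ 0ₚ
  ∷≋0ₚ a≈0 p≋0 = coeffwise λ { zero → a≈0 ; (suc i) → coeff-≈ p≋0 i }

  ∷≋0ₚ⁻¹ : ∀ {a p} → a ∷ p ≋ 0ₚ → a ≈ 0# × p ≋ 0ₚ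
  ∷≋0ₚ⁻¹ e = coeff-≈ e 0 , coeffwise (coeff-≈ e ∘ suc)

  infix 8 -ₚ_
  -ₚ_ : Pol → Pol
  -ₚ_ = map (-_)

  infixr 7 _·ₚ_
  _·ₚ_ : Carrier → Pol → Pol
  a ·ₚ p = map (a *_) p

  coeff-+ₚ : ∀ p q i → coeff (p +ₚ q) i ≈ coeff p i + coeff q i
  coeff-+ₚ []      q       i       = sym (+-identityˡ _)
  coeff-+ₚ (a ∷ p) []      i       = sym (+-identityʳ _)
  coeff-+ₚ (a ∷ p) (b ∷ q) zero    = refl
  coeff-+ₚ (a ∷ p) (b ∷ q) (suc i) = coeff-+ₚ p q i

  coeff-·ₚ : ∀ a p i → coeff (a ·ₚ p) i ≈ a * coeff p i
  coeff-·ₚ a []      i       = sym (zeroʳ a)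
  coeff-·ₚ a (b ∷ p) zero    = refl
  coeff-·ₚ a (b ∷ p) (suc i) = coeff-·ₚ a p i

  coeff--ₚ : ∀ p i → coeff (-ₚ p) i ≈ - coeff p i
  coeff--ₚ []      i       = sym (GroupProperties.ε⁻¹≈ε +-group)
  coeff--ₚ (a ∷ p) zero    = refl
  coeff--ₚ (a ∷ p) (suc i) = coeff--ₚ p i

  +ₚ-cong : ∀ {p p′ q q′} → p ≋ p′ → q ≋ q′ → p +ₚ q ≋ p′ +ₚ q′
  +ₚ-cong {p} {p′} {q} {q′} p≋p′ q≋q′ = coeffwise λ i → begin
    coeff (p +ₚ q) i          ≈⟨ coeff-+ₚ p q i ⟩
    coeff p i + coeff q i     ≈⟨ +-cong (coeff-≈ p≋p′ i) (coeff-≈ q≋q′ i) ⟩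
    coeff p′ i + coeff q′ i   ≈⟨ coeff-+ₚ p′ q′ i ⟨
    coeff (p′ +ₚ q′) i        ∎
    where open ≈-Reasoning

  +ₚ-assoc : ∀ p q r → (p +ₚ q) +ₚ r ≋ p +ₚ (q +ₚ r)
  +ₚ-assoc p q r = coeffwise λ i → begin
    coeff ((p +ₚ q) +ₚ r) i                ≈⟨ coeff-+ₚ (p +ₚ q) r i ⟩
    coeff (p +ₚ q) i + coeff r i           ≈⟨ +-congʳ (coeff-+ₚ p q i) ⟩
    (coeff p i + coeff q i) + coeff r i    ≈⟨ +-assoc _ _ _ ⟩
    coeff p i + (coeff q i + coeff r i)    ≈⟨ +-congˡ (coeff-+ₚ q r i) ⟨
    coeff p i + coeff (q +ₚ r) i           ≈⟨ coeff-+ₚ p (q +ₚ r) i ⟨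
    coeff (p +ₚ (q +ₚ r)) i                ∎
    where open ≈-Reasoning

  +ₚ-comm : ∀ p q → p +ₚ q ≋ q +ₚ p
  +ₚ-comm p q = coeffwise λ i →
    trans (coeff-+ₚ p q i) (trans (+-comm _ _) (sym (coeff-+ₚ q p i)))

  +ₚ-identityˡ : ∀ p → 0ₚ +ₚ p ≋ p
  +ₚ-identityˡ p = ≋-refl

  -ₚ-cong : ∀ {p q} → p ≋ q → -ₚ p ≋ -ₚ q
  -ₚ-cong {p} {q} p≋q = coeffwise λ i →
    trans (coeff--ₚ p i) (trans (-‿cong (coeff-≈ p≋q i)) (sym (coeff--ₚ q i)))

  -ₚ-inverseˡ : ∀ p → -ₚ p +ₚ p ≋ 0ₚ
  -ₚ-inverseˡ p = coeffwise λ i → begin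
    coeff (-ₚ p +ₚ p) i        ≈⟨ coeff-+ₚ (-ₚ p) p i ⟩
    coeff (-ₚ p) i + coeff p i ≈⟨ +-congʳ (coeff--ₚ p i) ⟩
    - coeff p i + coeff p i    ≈⟨ -‿inverseˡ _ ⟩
    0#                         ∎
    where open ≈-Reasoning

  open import Algebra.Definitions _≋_ using (_DistributesOver_)
  open Consequences ≋-setoid using (comm∧idˡ⇒id; comm∧invˡ⇒inv; comm∧distrˡ⇒distr)

  +ₚ-isAbelianGroup : IsAbelianGroup _≋_ _+ₚ_ 0ₚ -ₚ_
  +ₚ-isAbelianGroup = record
    { isGroup = record
      { isMonoid = record
        { isSemigroup = record
          { isMagma = record { isEquivalence = ≋-isEquivalence ; ∙-cong = +ₚ-cong }
          ; assoc   = +ₚ-assoc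
          }
        ; identity = comm∧idˡ⇒id +ₚ-comm +ₚ-identityˡ
        }
      ; inverse = comm∧invˡ⇒inv +ₚ-comm -ₚ-inverseˡ
      ; ⁻¹-cong = -ₚ-cong
      }
    ; comm = +ₚ-comm
    }

  +ₚ-abelianGroup : AbelianGroup c ℓ
  +ₚ-abelianGroup = record { isAbelianGroup = +ₚ-isAbelianGroup }

  open CommutativeSemigroupProperties (AbelianGroup.commutativeSemigroup +ₚ-abelianGroup)
    using (interchange; x∙yz≈y∙xz)

  ·ₚ-cong : ∀ {a b p q} → a ≈ b → p ≋ q → a ·ₚ p ≋ b ·ₚ q
  ·ₚ-cong {a} {b} {p} {q} a≈b p≋q = coeffwise λ i →
    trans (coeff-·ₚ a p i) (trans (*-cong a≈b (coeff-≈ p≋q i)) (sym (coeff-·ₚ b q i)))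

  ·ₚ-distrib-+ₚ : ∀ a p q → a ·ₚ (p +ₚ q) ≋ a ·ₚ p +ₚ a ·ₚ q
  ·ₚ-distrib-+ₚ a p q = coeffwise λ i → begin
    coeff (a ·ₚ (p +ₚ q)) i                  ≈⟨ coeff-·ₚ a (p +ₚ q) i ⟩
    a * coeff (p +ₚ q) i                     ≈⟨ *-congˡ (coeff-+ₚ p q i) ⟩
    a * (coeff p i + coeff q i)              ≈⟨ distribˡ a _ _ ⟩
    a * coeff p i + a * coeff q i            ≈⟨ +-cong (coeff-·ₚ a p i) (coeff-·ₚ a q i) ⟨
    coeff (a ·ₚ p) i + coeff (a ·ₚ q) i      ≈⟨ coeff-+ₚ (a ·ₚ p) _ i ⟨
    coeff (a ·ₚ p +ₚ a ·ₚ q) i               ∎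
    where open ≈-Reasoning

  ·ₚ-assoc : ∀ a b p → a ·ₚ b ·ₚ p ≋ (a * b) ·ₚ p
  ·ₚ-assoc a b p = coeffwise λ i → begin
    coeff (a ·ₚ b ·ₚ p) i    ≈⟨ trans (coeff-·ₚ a (b ·ₚ p) i) (*-congˡ (coeff-·ₚ b p i)) ⟩
    a * (b * coeff p i)      ≈⟨ *-assoc a b _ ⟨
    (a * b) * coeff p i      ≈⟨ coeff-·ₚ (a * b) p i ⟨
    coeff ((a * b) ·ₚ p) i   ∎
    where open ≈-Reasoning

  ·ₚ-identity : ∀ p → 1# ·ₚ p ≋ p
  ·ₚ-identity p = coeffwise λ i → trans (coeff-·ₚ 1# p i) (*-identityˡ _)

  ·ₚ-zero : ∀ {a} p → a ≈ 0# → a ·ₚ p ≋ 0ₚ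
  ·ₚ-zero {a} p a≈0 = coeffwise λ i → trans (coeff-·ₚ a p i) (trans (*-congʳ a≈0) (zeroˡ _))

  *ₚ-congʳ : ∀ p {q q′} → q ≋ q′ → p *ₚ q ≋ p *ₚ q′
  *ₚ-congʳ []      q≋q′ = ≋-refl
  *ₚ-congʳ (a ∷ p) q≋q′ = +ₚ-cong (·ₚ-cong refl q≋q′) (∷-cong refl (*ₚ-congʳ p q≋q′))

  *ₚ-zeroʳ : ∀ p → p *ₚ 0ₚ ≋ 0ₚ
  *ₚ-zeroʳ []      = ≋-refl
  *ₚ-zeroʳ (a ∷ p) = ∷≋0ₚ refl (*ₚ-zeroʳ p)

  0∷-*ₚ : ∀ {a} p q → a ≈ 0# → (a ∷ p) *ₚ q ≋ 0# ∷ p *ₚ q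
  0∷-*ₚ p q a≈0 = +ₚ-cong (·ₚ-zero q a≈0) ≋-refl

  *ₚ-∷ : ∀ p b q → p *ₚ (b ∷ q) ≋ b ·ₚ p +ₚ (0# ∷ p *ₚ q)
  *ₚ-∷ []      b q = ≋-sym (∷≋0ₚ refl ≋-refl)
  *ₚ-∷ (a ∷ p) b q = ∷-cong (+-congʳ (*-comm a b)) (begin
      a ·ₚ q +ₚ p *ₚ (b ∷ q)                   ≈⟨ +ₚ-cong ≋-refl (*ₚ-∷ p b q) ⟩
      a ·ₚ q +ₚ (b ·ₚ p +ₚ (0# ∷ p *ₚ q))      ≈⟨ x∙yz≈y∙xz (a ·ₚ q) (b ·ₚ p) _ ⟩
      b ·ₚ p +ₚ (a ·ₚ q +ₚ (0# ∷ p *ₚ q))      ∎)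
    where open ≋-Reasoning

  *ₚ-comm : ∀ p q → p *ₚ q ≋ q *ₚ p
  *ₚ-comm []      q = ≋-sym (*ₚ-zeroʳ q)
  *ₚ-comm (a ∷ p) q =
    ≋-trans (+ₚ-cong ≋-refl (∷-cong refl (*ₚ-comm p q))) (≋-sym (*ₚ-∷ q a p))

  *ₚ-congˡ : ∀ {p p′} q → p ≋ p′ → p *ₚ q ≋ p′ *ₚ q
  *ₚ-congˡ {p} {p′} q p≋p′ =
    ≋-trans (*ₚ-comm p q) (≋-trans (*ₚ-congʳ q p≋p′) (*ₚ-comm q p′))

  *ₚ-cong : ∀ {p p′ q q′} → p ≋ p′ → q ≋ q′ → p *ₚ q ≋ p′ *ₚ q′
  *ₚ-cong {p′ = p′} {q = q} p≋p′ q≋q′ = ≋-trans (*ₚ-congˡ q p≋p′) (*ₚ-congʳ p′ q≋q′)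

  *ₚ-distribˡ : ∀ p q r → p *ₚ (q +ₚ r) ≋ p *ₚ q +ₚ p *ₚ r
  *ₚ-distribˡ []      q r = ≋-refl
  *ₚ-distribˡ (a ∷ p) q r = begin
      a ·ₚ (q +ₚ r) +ₚ (0# ∷ p *ₚ (q +ₚ r))
    ≈⟨ +ₚ-cong (·ₚ-distrib-+ₚ a q r) (∷-cong (sym (+-identityˡ 0#)) (*ₚ-distribˡ p q r)) ⟩
      (a ·ₚ q +ₚ a ·ₚ r) +ₚ ((0# ∷ p *ₚ q) +ₚ (0# ∷ p *ₚ r))
    ≈⟨ interchange (a ·ₚ q) _ _ _ ⟩
      (a ·ₚ q +ₚ (0# ∷ p *ₚ q)) +ₚ (a ·ₚ r +ₚ (0# ∷ p *ₚ r))
    ∎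
    where open ≋-Reasoning

  *ₚ-distrib : _DistributesOver_ _*ₚ_ _+ₚ_
  *ₚ-distrib = comm∧distrˡ⇒distr +ₚ-cong *ₚ-comm *ₚ-distribˡ

  *ₚ-distribʳ : ∀ p q r → (q +ₚ r) *ₚ p ≋ q *ₚ p +ₚ r *ₚ p
  *ₚ-distribʳ = proj₂ *ₚ-distrib

  ·ₚ-*ₚ : ∀ a p q → a ·ₚ (p *ₚ q) ≋ (a ·ₚ p) *ₚ q
  ·ₚ-*ₚ a []      q = ≋-refl
  ·ₚ-*ₚ a (b ∷ p) q = begin
      a ·ₚ (b ·ₚ q +ₚ (0# ∷ p *ₚ q))
    ≈⟨ ·ₚ-distrib-+ₚ a (b ·ₚ q) _ ⟩
      a ·ₚ b ·ₚ q +ₚ ((a * 0#) ∷ a ·ₚ (p *ₚ q))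
    ≈⟨ +ₚ-cong (·ₚ-assoc a b q) (∷-cong (zeroʳ a) (·ₚ-*ₚ a p q)) ⟩
      (a * b) ·ₚ q +ₚ (0# ∷ (a ·ₚ p) *ₚ q)
    ∎
    where open ≋-Reasoning

  *ₚ-assoc : ∀ p q r → (p *ₚ q) *ₚ r ≋ p *ₚ (q *ₚ r)
  *ₚ-assoc []      q r = ≋-refl
  *ₚ-assoc (a ∷ p) q r = begin
      (a ·ₚ q +ₚ (0# ∷ p *ₚ q)) *ₚ r
    ≈⟨ *ₚ-distribʳ r (a ·ₚ q) _ ⟩
      (a ·ₚ q) *ₚ r +ₚ (0# ∷ p *ₚ q) *ₚ r
    ≈⟨ +ₚ-cong (≋-sym (·ₚ-*ₚ a q r)) (0∷-*ₚ (p *ₚ q) r refl) ⟩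
      a ·ₚ (q *ₚ r) +ₚ (0# ∷ (p *ₚ q) *ₚ r)
    ≈⟨ +ₚ-cong ≋-refl (∷-cong refl (*ₚ-assoc p q r)) ⟩
      a ·ₚ (q *ₚ r) +ₚ (0# ∷ p *ₚ (q *ₚ r))
    ∎
    where open ≋-Reasoning

  *ₚ-identityˡ : ∀ p → 1ₚ *ₚ p ≋ p
  *ₚ-identityˡ p = ≋-trans (+ₚ-cong (·ₚ-identity p) (∷≋0ₚ refl ≋-refl)) (+ₚ-comm p [])

  *ₚ-identityʳ : ∀ p → p *ₚ 1ₚ ≋ p
  *ₚ-identityʳ p = ≋-trans (*ₚ-comm p 1ₚ) (*ₚ-identityˡ p)

  Pol-commutativeRing : CommutativeRing c ℓ
  Pol-commutativeRing = record
    { Carrier = Pol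
    ; _≈_ = _≋_
    ; _+_ = _+ₚ_
    ; _*_ = _*ₚ_
    ; -_  = -ₚ_
    ; 0#  = 0ₚ
    ; 1#  = 1ₚ
    ; isCommutativeRing = record
      { isRing = record
        { +-isAbelianGroup = +ₚ-isAbelianGroup
        ; *-cong     = *ₚ-cong
        ; *-assoc    = *ₚ-assoc
        ; *-identity = *ₚ-identityˡ , *ₚ-identityʳ
        ; distrib    = *ₚ-distrib
        }
      ; *-comm = *ₚ-comm
      }
    }

  module _ (lem : ∀ {a} → ExcludedMiddle a) (dom : IsIntegralDomain A) where

    ∷-*ₚ-nonzero : ∀ {a} p q → ¬ a ≈ 0# → ¬ q ≋ 0ₚ → ¬ (a ∷ p) *ₚ q ≋ 0ₚ
    ∷-*ₚ-nonzero p []      a≉0 q≉0 _ = q≉0 ≋-refl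
    ∷-*ₚ-nonzero {a} p (b ∷ q) a≉0 b∷q≉0 e with lem {P = b ≈ 0#}
    ... | yes b≈0 = ∷-*ₚ-nonzero p q a≉0 (b∷q≉0 ∘ ∷≋0ₚ b≈0) (proj₂ (∷≋0ₚ⁻¹ (begin
        0# ∷ (a ∷ p) *ₚ q                       ≈⟨ +ₚ-cong (·ₚ-zero (a ∷ p) b≈0) ≋-refl ⟨
        b ·ₚ (a ∷ p) +ₚ (0# ∷ (a ∷ p) *ₚ q)     ≈⟨ *ₚ-∷ (a ∷ p) b q ⟨
        (a ∷ p) *ₚ (b ∷ q)                      ≈⟨ e ⟩
        0ₚ                                      ∎)))
      where open ≋-Reasoning
    ... | no b≉0 with proj₂ dom a b (trans (sym (+-identityʳ (a * b))) (coeff-≈ e 0))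
    ...   | inj₁ a≈0 = a≉0 a≈0
    ...   | inj₂ b≈0 = b≉0 b≈0

    -- Excluded middle strips vanishing constant terms; once both constant terms
    -- are nonzero, so is the constant term of the product.
    *ₚ-nonzero : ∀ p q → ¬ p ≋ 0ₚ → ¬ q ≋ 0ₚ → ¬ p *ₚ q ≋ 0ₚ
    *ₚ-nonzero []      q p≉0 _ _ = p≉0 ≋-refl
    *ₚ-nonzero (a ∷ p) q a∷p≉0 q≉0 e with lem {P = a ≈ 0#}
    ... | yes a≈0 = *ₚ-nonzero p q (a∷p≉0 ∘ ∷≋0ₚ a≈0) q≉0
                      (proj₂ (∷≋0ₚ⁻¹ (≋-trans (≋-sym (0∷-*ₚ p q a≈0)) e)))
    ... | no a≉0 = ∷-*ₚ-nonzero p q a≉0 q≉0 e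

    Pol-isIntegralDomain : IsIntegralDomain Pol-commutativeRing
    Pol-isIntegralDomain = proj₁ dom ∘ proj₁ ∘ ∷≋0ₚ⁻¹ , zeroDivisor
      where
      zeroDivisor : ∀ p q → p *ₚ q ≋ 0ₚ → p ≋ 0ₚ ⊎ q ≋ 0ₚ
      zeroDivisor p q pq≋0 with lem {P = p ≋ 0ₚ} | lem {P = q ≋ 0ₚ}
      ... | yes p≋0 | _       = inj₁ p≋0
      ... | no _    | yes q≋0 = inj₂ q≋0
      ... | no p≉0  | no q≉0  = ⊥-elim (*ₚ-nonzero p q p≉0 q≉0 pq≋0)

module Construction
  (lem : ∀ {a} → ExcludedMiddle a)
  {c ℓ} (A : CommutativeRing c ℓ) (dom : IsIntegralDomain A)
  (α : ℕ → Poly.Pol A → Poly.Pol A) (α-hom : Poly.IsHomα A α)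
  (u : ℕ → ℕ) (u-hom : IsHomN u)
  (P : ℕ → Set) (P⇒prime : ∀ p → P p → Prime p)
  (h : ℕ → Poly.Pol A)
  (h-nonzero : ∀ p → P p → ¬ Poly._≈ₚ_ A (h p) (Poly.0ₚ A))
  (h-comm : ∀ p₁ p₂ → P p₁ → P p₂ →
              Poly._≈ₚ_ A (Poly._*ₚ_ A (h p₁) (α (u p₁) (h p₂)))
                          (Poly._*ₚ_ A (h p₂) (α (u p₂) (h p₁))))
  where

  open Poly A
  open Polynomial A
  open IntegralDomain Pol-commutativeRing (Pol-isIntegralDomain lem dom)
    using (nonzero-idempotent⇒≈1)

  module _ {t} (1≤t : 1 ≤ t) where
    private
      α-end = proj₁ α-hom t 1≤t

    α-cong : ∀ {f g} → f ≋ g → α t f ≋ α t g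
    α-cong {f} {g} f≋g = ≈ₚ⇒≋ (proj₁ α-end f g (≋⇒≈ₚ f≋g))

    α-1ₚ : α t 1ₚ ≋ 1ₚ
    α-1ₚ = ≈ₚ⇒≋ (proj₁ (proj₂ α-end))

    α-*ₚ : ∀ f g → α t (f *ₚ g) ≋ α t f *ₚ α t g
    α-*ₚ f g = ≈ₚ⇒≋ (proj₁ (proj₂ (proj₂ α-end)) f g)

    α-0ₚ : α t 0ₚ ≋ 0ₚ
    α-0ₚ = ≈ₚ⇒≋ (proj₁ (proj₂ (proj₂ (proj₂ α-end))))

    α-nonzero : ∀ {f} → ¬ f ≋ 0ₚ → ¬ α t f ≋ 0ₚ
    α-nonzero {f} f≉0 = proj₂ (proj₂ (proj₂ (proj₂ α-end))) f (f≉0 ∘ ≈ₚ⇒≋) ∘ ≋⇒≈ₚ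

  α-identity : ∀ f → α 1 f ≋ f
  α-identity f = ≈ₚ⇒≋ (proj₁ (proj₂ α-hom) f)

  α-∘ : ∀ {m n} → 1 ≤ m → 1 ≤ n → ∀ f → α (m ℕ.* n) f ≋ α m (α n f)
  α-∘ 1≤m 1≤n f = ≈ₚ⇒≋ (proj₂ (proj₂ α-hom) _ _ 1≤m 1≤n f)

  *ₚ-α-assoc : ∀ {a b} → 1 ≤ a → 1 ≤ b → ∀ f g k →
               f *ₚ α a (g *ₚ α b k) ≋ (f *ₚ α a g) *ₚ α (a ℕ.* b) k
  *ₚ-α-assoc {a} {b} 1≤a 1≤b f g k = begin
    f *ₚ α a (g *ₚ α b k)           ≈⟨ *ₚ-congʳ f (α-*ₚ 1≤a g (α b k)) ⟩
    f *ₚ (α a g *ₚ α a (α b k))     ≈⟨ *ₚ-assoc f (α a g) _ ⟨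
    (f *ₚ α a g) *ₚ α a (α b k)     ≈⟨ *ₚ-congʳ (f *ₚ α a g) (α-∘ 1≤a 1≤b k) ⟨
    (f *ₚ α a g) *ₚ α (a ℕ.* b) k   ∎
    where open ≋-Reasoning

  u-positive : ∀ {n} → 1 ≤ n → 1 ≤ u n
  u-positive = proj₁ u-hom _

  u-1 : u 1 ≡ 1
  u-1 = proj₁ (proj₂ u-hom)

  u-* : ∀ {m n} → 1 ≤ m → 1 ≤ n → u (m ℕ.* n) ≡ u m ℕ.* u n
  u-* = proj₂ (proj₂ u-hom) _ _

  P⇒1≤u : ∀ {p} → P p → 1 ≤ u p
  P⇒1≤u {p} Pp = u-positive (prime⇒1≤ (P⇒prime p Pp))

  -- p ▹ g is the value h_p α_{u(p)}(g) that f_{pm} must take when f_m = g;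
  -- it is 0 when p ∉ P, as f_{pm} must vanish outside S(P).
  infixr 5 _▹_
  _▹_ : ℕ → Pol → Pol
  p ▹ g with lem {P = P p}
  ... | yes _ = h p *ₚ α (u p) g
  ... | no _  = 0ₚ

  ▹-P : ∀ {p} → P p → ∀ g → p ▹ g ≋ h p *ₚ α (u p) g
  ▹-P {p} Pp g with lem {P = P p}
  ... | yes _  = ≋-refl
  ... | no ¬Pp = contradiction Pp ¬Pp


  h-α-0ₚ : ∀ {p} → P p → h p *ₚ α (u p) 0ₚ ≋ 0ₚ
  h-α-0ₚ {p} Pp = ≋-trans (*ₚ-congʳ (h p) (α-0ₚ (P⇒1≤u Pp))) (*ₚ-zeroʳ (h p))

  ▹-cong : ∀ p {g g′} → g ≋ g′ → p ▹ g ≋ p ▹ g′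
  ▹-cong p g≋g′ with lem {P = P p}
  ... | yes Pp = *ₚ-congʳ (h p) (α-cong (P⇒1≤u Pp) g≋g′)
  ... | no _   = ≋-refl

  ▹-*ₚ : ∀ p {m} → 1 ≤ m → ∀ g k → p ▹ (g *ₚ α (u m) k) ≋ (p ▹ g) *ₚ α (u (p ℕ.* m)) k
  ▹-*ₚ p {m} 1≤m g k with lem {P = P p}
  ... | yes Pp = ≋-trans (*ₚ-α-assoc (P⇒1≤u Pp) (u-positive 1≤m) (h p) g k)
                         (*ₚ-congʳ (h p *ₚ α (u p) g) (≋-reflexive (cong (λ t → α t k)
                           (≡.sym (u-* (prime⇒1≤ (P⇒prime p Pp)) 1≤m)))))
  ... | no _   = ≋-refl

  ▹-comm : ∀ p q g → p ▹ q ▹ g ≋ q ▹ p ▹ g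
  ▹-comm p q g with lem {P = P p} | lem {P = P q}
  ... | yes Pp | yes Pq = begin
      h p *ₚ α (u p) (h q *ₚ α (u q) g)          ≈⟨ *ₚ-α-assoc 1≤up 1≤uq (h p) (h q) g ⟩
      (h p *ₚ α (u p) (h q)) *ₚ α (u p ℕ.* u q) g ≈⟨ *ₚ-cong (≈ₚ⇒≋ (h-comm p q Pp Pq)) uv≡vu ⟩
      (h q *ₚ α (u q) (h p)) *ₚ α (u q ℕ.* u p) g ≈⟨ *ₚ-α-assoc 1≤uq 1≤up (h q) (h p) g ⟨
      h q *ₚ α (u q) (h p *ₚ α (u p) g)          ∎
    where
    open ≋-Reasoning
    1≤up = P⇒1≤u Pp
    1≤uq = P⇒1≤u Pq
    uv≡vu = ≋-reflexive (cong (λ t → α t g) (ℕₚ.*-comm (u p) (u q)))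
  ... | yes Pp | no _   = h-α-0ₚ Pp
  ... | no _   | yes Pq = ≋-sym (h-α-0ₚ Pq)
  ... | no _   | no _   = ≋-refl

  ▹-nonzero : ∀ {p g} → P p → ¬ g ≋ 0ₚ → ¬ p ▹ g ≋ 0ₚ
  ▹-nonzero {p} {g} Pp g≉0 = *ₚ-nonzero lem dom (h p) _ (h-nonzero p Pp ∘ ≋⇒≈ₚ)
                                 (α-nonzero (P⇒1≤u Pp) g≉0) ∘ ≋-trans (≋-sym (▹-P Pp g))

  ▹-nonzero⁻¹ : ∀ p {g} → ¬ p ▹ g ≋ 0ₚ → P p × ¬ g ≋ 0ₚ
  ▹-nonzero⁻¹ p {g} ▹≉0 with lem {P = P p}
  ... | yes Pp = Pp , λ g≋0 → ▹≉0 (≋-trans (*ₚ-congʳ (h p) (α-cong (P⇒1≤u Pp) g≋0)) (h-α-0ₚ Pp))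
  ... | no _   = contradiction ≋-refl ▹≉0

  fromFactors : List ℕ → Pol
  fromFactors = foldr _▹_ 1ₚ

  fromFactors-↭ : ∀ {xs ys} → xs ↭ ys → fromFactors xs ≋ fromFactors ys
  fromFactors-↭ ↭.refl                  = ≋-refl
  fromFactors-↭ (↭.prep x xs↭ys)        = ▹-cong x (fromFactors-↭ xs↭ys)
  fromFactors-↭ (↭.swap x y xs↭ys)      =
    ≋-trans (▹-cong x (▹-cong y (fromFactors-↭ xs↭ys))) (▹-comm x y _)
  fromFactors-↭ (↭.trans xs↭ys ys↭zs)   = ≋-trans (fromFactors-↭ xs↭ys) (fromFactors-↭ ys↭zs)

  fromFactors-++ : ∀ {xs} → All Prime xs → ∀ ys →
                   fromFactors (xs ++ ys) ≋ fromFactors xs *ₚ α (u (product xs)) (fromFactors ys)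
  fromFactors-++ {[]} [] ys = begin
    fromFactors ys                      ≈⟨ α-identity _ ⟨
    α 1 (fromFactors ys)                ≈⟨ ≋-reflexive (cong (λ t → α t (fromFactors ys)) u-1) ⟨
    α (u 1) (fromFactors ys)            ≈⟨ *ₚ-identityˡ _ ⟨
    1ₚ *ₚ α (u 1) (fromFactors ys)      ∎
    where open ≋-Reasoning
  fromFactors-++ {x ∷ xs} (_ ∷ xs-prime) ys =
    ≋-trans (▹-cong x (fromFactors-++ xs-prime ys))
            (▹-*ₚ x (productOfPrimes≥1 xs-prime) (fromFactors xs) (fromFactors ys))

  fromFactors-nonzero : ∀ {xs} → All P xs → ¬ fromFactors xs ≋ 0ₚ
  fromFactors-nonzero []          = proj₁ dom ∘ proj₁ ∘ ∷≋0ₚ⁻¹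
  fromFactors-nonzero (Px ∷ P-xs) = ▹-nonzero Px (fromFactors-nonzero P-xs)

  fromFactors-nonzero⁻¹ : ∀ xs → ¬ fromFactors xs ≋ 0ₚ → All P xs
  fromFactors-nonzero⁻¹ []       _  = []
  fromFactors-nonzero⁻¹ (x ∷ xs) ≉0 =
    let Px , rest≉0 = ▹-nonzero⁻¹ x ≉0 in Px ∷ fromFactors-nonzero⁻¹ xs rest≉0

  -- 0 ∉ N, so the value f 0 is never constrained.
  f : ℕ → Pol
  f zero        = 0ₚ
  f n@(suc _)   = fromFactors (factors (factorise n))

  f-factorisation : ∀ {n} (φ : PrimeFactorisation n) → f n ≋ fromFactors (factors φ)
  f-factorisation {zero}  φ = contradiction (≡.sym (isFactorisation φ))
                                (ℕ.≢-nonZero⁻¹ _ {{productOfPrimes≢0 (factorsPrime φ)}})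
  f-factorisation {suc n} φ = fromFactors-↭ (factorisationUnique (factorise (suc n)) φ)

  f-funEq : ∀ {m n} → 1 ≤ m → 1 ≤ n → f (m ℕ.* n) ≋ f m *ₚ α (u m) (f n)
  f-funEq {m} {n} 1≤m 1≤n = begin
      f (m ℕ.* n)
    ≈⟨ f-factorisation (factorisation-* φ ψ) ⟩
      fromFactors (factors φ ++ factors ψ)
    ≈⟨ fromFactors-++ (factorsPrime φ) (factors ψ) ⟩
      fromFactors (factors φ) *ₚ α (u (product (factors φ))) (fromFactors (factors ψ))
    ≡⟨ cong (λ t → fromFactors (factors φ) *ₚ α (u t) (fromFactors (factors ψ)))
            (≡.sym (isFactorisation φ)) ⟩
      fromFactors (factors φ) *ₚ α (u m) (fromFactors (factors ψ))
    ≈⟨ *ₚ-cong (f-factorisation φ) (α-cong (u-positive 1≤m) (f-factorisation ψ)) ⟨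
      f m *ₚ α (u m) (f n)
    ∎
    where
    open ≋-Reasoning
    φ = factorisation 1≤m
    ψ = factorisation 1≤n

  f-prime : ∀ {p} → P p → f p ≋ h p
  f-prime {p} Pp = begin
    f p                  ≈⟨ f-factorisation (primeFactorisation[p] (P⇒prime p Pp)) ⟩
    p ▹ 1ₚ               ≈⟨ ▹-P Pp 1ₚ ⟩
    h p *ₚ α (u p) 1ₚ    ≈⟨ *ₚ-congʳ (h p) (α-1ₚ (P⇒1≤u Pp)) ⟩
    h p *ₚ 1ₚ            ≈⟨ *ₚ-identityʳ (h p) ⟩
    h p                  ∎
    where open ≋-Reasoning

  f-support : ∀ {n} → 1 ≤ n → (¬ f n ≋ 0ₚ → InS P n) × (InS P n → ¬ f n ≋ 0ₚ)
  f-support 1≤n =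
      (λ fn≉0 → All⇒InS φ (fromFactors-nonzero⁻¹ _ (fn≉0 ∘ ≋-trans (f-factorisation φ))))
    , (λ n∈S → fromFactors-nonzero (InS⇒All φ n∈S) ∘ ≋-trans (≋-sym (f-factorisation φ)))
    where φ = factorisation 1≤n

  f-good : Good α u P h f
  f-good = (λ _ _ 1≤m 1≤n → ≋⇒≈ₚ (f-funEq 1≤m 1≤n))
         , (λ _ Pp → ≋⇒≈ₚ (f-prime Pp))
         , λ _ 1≤n → (λ fn≉0 → proj₁ (f-support 1≤n) (fn≉0 ∘ ≋⇒≈ₚ))
                   , (λ n∈S → proj₂ (f-support 1≤n) n∈S ∘ ≈ₚ⇒≋)

  module _ {g} (g-good : Good α u P h g) where
    private
      g-funEq  = proj₁ g-good
      g-prime  = proj₁ (proj₂ g-good)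
      g-support = proj₂ (proj₂ g-good)

    g-vanishes : ∀ {n} → 1 ≤ n → ¬ InS P n → g n ≋ 0ₚ
    g-vanishes {n} 1≤n n∉S with lem {P = g n ≋ 0ₚ}
    ... | yes gn≋0 = gn≋0
    ... | no gn≉0  = contradiction (proj₁ (g-support n 1≤n) (gn≉0 ∘ ≈ₚ⇒≋)) n∉S

    g-1 : g 1 ≋ 1ₚ
    g-1 = nonzero-idempotent⇒≈1 g1≉0 (≋-sym (begin
      g 1                    ≈⟨ ≈ₚ⇒≋ (g-funEq 1 1 ℕₚ.≤-refl ℕₚ.≤-refl) ⟩
      g 1 *ₚ α (u 1) (g 1)   ≡⟨ cong (λ t → g 1 *ₚ α t (g 1)) u-1 ⟩
      g 1 *ₚ α 1 (g 1)       ≈⟨ *ₚ-congʳ (g 1) (α-identity (g 1)) ⟩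
      g 1 *ₚ g 1             ∎))
      where
      open ≋-Reasoning
      g1≉0 : ¬ g 1 ≋ 0ₚ
      g1≉0 = proj₂ (g-support 1 ℕₚ.≤-refl) (All⇒InS primeFactorisation[1] []) ∘ ≋⇒≈ₚ

    g-fromFactors : ∀ {xs} → All Prime xs → g (product xs) ≋ fromFactors xs
    g-fromFactors []                               = g-1
    g-fromFactors {x ∷ xs} (x-prime ∷ xs-prime) with lem {P = P x}
    ... | yes Px = ≋-trans (≈ₚ⇒≋ (g-funEq x _ (prime⇒1≤ x-prime) (productOfPrimes≥1 xs-prime)))
                           (*ₚ-cong (≈ₚ⇒≋ (g-prime x Px))
                                    (α-cong (P⇒1≤u Px) (g-fromFactors xs-prime)))
    ... | no ¬Px = g-vanishes (productOfPrimes≥1 (x-prime ∷ xs-prime))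
                              (λ x*xs∈S → ¬Px (proj₂ x*xs∈S x x-prime (m∣m*n (product xs))))

    good⇒≋f : ∀ {n} → 1 ≤ n → g n ≋ f n
    good⇒≋f {n} 1≤n = begin
      g n                         ≡⟨ cong g (isFactorisation φ) ⟩
      g (product (factors φ))     ≈⟨ g-fromFactors (factorsPrime φ) ⟩
      fromFactors (factors φ)     ≈⟨ f-factorisation φ ⟨
      f n                         ∎
      where
      open ≋-Reasoning
      φ = factorisation 1≤n

theorem5 : (lem : ∀ {a} → ExcludedMiddle a)
    → ∀ {c ℓ : Level} (A : CommutativeRing c ℓ) → IsIntegralDomain A
    → (α : ℕ → Poly.Pol A → Poly.Pol A) → Poly.IsHomα A α
    → (u : ℕ → ℕ) → IsHomN u
    → (P : ℕ → Set) → (∀ p → P p → Prime p)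
    → (h : ℕ → Poly.Pol A)
    → (∀ p → P p → ¬ (Poly._≈ₚ_ A (h p) (Poly.0ₚ A)))
    → (∀ p₁ p₂ → P p₁ → P p₂ →
         Poly._≈ₚ_ A (Poly._*ₚ_ A (h p₁) (α (u p₁) (h p₂)))
                     (Poly._*ₚ_ A (h p₂) (α (u p₂) (h p₁))))
    → Σ (ℕ → Poly.Pol A) (λ f →
         Poly.Good A α u P h f
         × (∀ g → Poly.Good A α u P h g → ∀ n → 1 ≤ n → Poly._≈ₚ_ A (g n) (f n)))
theorem5 lem A dom α α-hom u u-hom P P⇒prime h h-nonzero h-comm =
  f , f-good , λ g g-good _ 1≤n → Polynomial.≋⇒≈ₚ A (good⇒≋f g-good 1≤n)
  where open Construction lem A dom α α-hom u u-hom P P⇒prime h h-nonzero h-comm
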